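{- Let $k \ge 1$ and $\delta \ge k+1$ be integers, and let $n$ be an integer such that $n - k$ is a positive even integer and $n-2\delta+k-3\ge 1$. Then the graph $K_\delta \vee ( K_{n-2\delta+k-3} \cup K_3 \cup (\delta - k)K_1 )$ is not $k$-factor-critical.
   Context: $K_m$ is the complete graph on $m$ vertices; $\cup$ is disjoint union; $G_1\vee G_2$ (join) is obtained from $G_1\cup G_2$ by adding all edges between $V(G_1)$ and $V(G_2)$; $aH$ denotes the disjoint union of $a$ copies of $H$. A graph $G$ of order $n$ is $k$-factor-critical (for $0\le k<n$) if for every set of $k$ vertices, deleting them leaves a graph with a perfect matching. -}

module Defs where

open import Data.Nat using (ℕ; zero; suc; _+_; _*_)
open import Data.Fin using (Fin; splitAt)
open import Data.Fin.Subset using (Subset; _∉_; ∣_∣)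
open import Data.Sum using (inj₁; inj₂)
open import Data.Product using (∃; _×_)
open import Data.Empty using (⊥)
open import Data.Unit using (⊤)
open import Relation.Binary.PropositionalEquality using (_≡_; _≢_)

Graph : ℕ → Set₁
Graph n = Fin n → Fin n → Set

K : (m : ℕ) → Graph m
K m i j = i ≢ j

_∪ᴳ_ : ∀ {a b} → Graph a → Graph b → Graph (a + b)
_∪ᴳ_ {a} G₁ G₂ i j with splitAt a i | splitAt a j
... | inj₁ x | inj₁ y = G₁ x y
... | inj₂ x | inj₂ y = G₂ x y
... | inj₁ _ | inj₂ _ = ⊥
... | inj₂ _ | inj₁ _ = ⊥

_∨ᴳ_ : ∀ {a b} → Graph a → Graph b → Graph (a + b)
_∨ᴳ_ {a} G₁ G₂ i j with splitAt a i | splitAt a j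
... | inj₁ x | inj₁ y = G₁ x y
... | inj₂ x | inj₂ y = G₂ x y
... | inj₁ _ | inj₂ _ = ⊤
... | inj₂ _ | inj₁ _ = ⊤

K∅ : Graph 0
K∅ () _

copies : ∀ {m} (a : ℕ) → Graph m → Graph (a * m)
copies zero    H = K∅
copies (suc a) H = H ∪ᴳ copies a H

-- G - S has a perfect matching, encoded by a partner function:
-- every vertex outside S is matched to a distinct adjacent vertex outside S,
-- and matching is symmetric.
HasPerfectMatchingAfterDeleting : ∀ {n} → Graph n → Subset n → Set
HasPerfectMatchingAfterDeleting {n} G S =
  ∃ λ (μ : Fin n → Fin n) → ∀ v → v ∉ S →
    (μ v ∉ S) × (μ v ≢ v) × G v (μ v) × (μ (μ v) ≡ v)

FactorCritical : ∀ {n} → ℕ → Graph n → Set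
FactorCritical {n} k G =
  ∀ (S : Subset n) → ∣ S ∣ ≡ k → HasPerfectMatchingAfterDeleting G S

{-# OPTIONS --safe #-}
-- Delete k vertices of K_δ. In what remains, the other δ - k vertices R of K_δ are the only
-- link between the components: each of the δ - k isolated vertices must be matched into R,
-- and since a triangle has no perfect matching, so must some vertex of K₃. That gives
-- δ - k + 1 vertices with distinct partners in a set of only δ - k vertices.
module Submission where

open import Defs
open import Data.Nat using (ℕ; suc; _+_; _*_; _∸_; _≤_; _<_)
open import Data.Nat.Properties using (*-identityʳ; ≤-reflexive; ≤-trans; m≤m+n; m+[n∸m]≡n)
open import Data.Fin using (Fin; zero; suc; _↑ˡ_; _↑ʳ_)
open import Data.Fin.Properties using (splitAt-↑ˡ; splitAt-↑ʳ; suc-injective; ↑ˡ-injective; ↑ʳ-injective; pigeonhole; <⇒≢)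
open import Data.Fin.Subset using (Subset; _∈_; _∉_; ∣_∣; inside; outside; ⊤) renaming (⊥ to ∅)
open import Data.Fin.Subset.Properties using (∈⊤; ∣⊤∣≡n) renaming (∉⊥ to ∉∅; ∣⊥∣≡0 to ∣∅∣≡0)
open import Data.Vec using (_∷_; []; _++_; here; there)
open import Data.Product using (∃; _×_; _,_; proj₁; proj₂)
open import Data.Sum using (_⊎_; inj₁; inj₂)
open import Data.Empty using (⊥; ⊥-elim)
open import Function using (_∘_)
open import Function.Definitions using (Injective)
open import Relation.Binary.PropositionalEquality using (_≡_; _≢_; refl; sym; trans; cong; subst; module ≡-Reasoning)
open import Relation.Nullary using (¬_; contradiction)

data SplitView (a b : ℕ) : Fin (a + b) → Set where
  left  : (x : Fin a) → SplitView a b (x ↑ˡ b)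
  right : (y : Fin b) → SplitView a b (a ↑ʳ y)

splitView : ∀ a {b} (i : Fin (a + b)) → SplitView a b i
splitView ℕ.zero    i       = right i
splitView (suc a)   zero    = left zero
splitView (suc a)   (suc i) with splitView a i
... | left x  = left (suc x)
... | right y = right y

↑ˡ≢↑ʳ : ∀ {a b} (x : Fin a) (y : Fin b) → x ↑ˡ b ≢ a ↑ʳ y
↑ˡ≢↑ʳ zero    y ()
↑ˡ≢↑ʳ (suc x) y eq = ↑ˡ≢↑ʳ x y (suc-injective eq)

∣p++∅∣≡∣p∣ : ∀ {m n} (p : Subset m) → ∣ p ++ ∅ {n} ∣ ≡ ∣ p ∣
∣p++∅∣≡∣p∣ {n = n} []    = ∣∅∣≡0 n
∣p++∅∣≡∣p∣ (inside  ∷ p) = cong suc (∣p++∅∣≡∣p∣ p)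
∣p++∅∣≡∣p∣ (outside ∷ p) = ∣p++∅∣≡∣p∣ p

∈-++⁺ˡ : ∀ {m n} {p : Subset m} {q : Subset n} {x} → x ∈ p → x ↑ˡ n ∈ p ++ q
∈-++⁺ˡ here        = here
∈-++⁺ˡ (there x∈p) = there (∈-++⁺ˡ x∈p)

∈-++⁻ʳ : ∀ {m n} (p : Subset m) {q : Subset n} {y} → m ↑ʳ y ∈ p ++ q → y ∈ q
∈-++⁻ʳ []      y∈q         = y∈q
∈-++⁻ʳ (_ ∷ p) (there y∈q) = ∈-++⁻ʳ p y∈q

∃⊎∀ : ∀ {n} {P Q : Fin n → Set} → (∀ i → P i ⊎ Q i) → ∃ P ⊎ (∀ i → Q i)
∃⊎∀ {ℕ.zero} P⊎Q = inj₂ λ ()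
∃⊎∀ {suc n}  P⊎Q with P⊎Q zero | ∃⊎∀ (P⊎Q ∘ suc)
... | inj₁ p₀ | _              = inj₁ (zero , p₀)
... | inj₂ _  | inj₁ (i , pᵢ)  = inj₁ (suc i , pᵢ)
... | inj₂ q₀ | inj₂ qₛ        = inj₂ λ { zero → q₀ ; (suc i) → qₛ i }

module _ (g : Fin 3 → Fin 3) (g∘g≡id : ∀ t → g (g t) ≡ t) where
  private
    swap : ∀ {a b} → g a ≡ b → g b ≡ a
    swap {a} refl = g∘g≡id a

  Fin3-involution-has-fixedPoint : ∃ λ t → g t ≡ t
  Fin3-involution-has-fixedPoint with g zero in e₀
  ... | zero = zero , e₀
  ... | suc zero with g (suc (suc zero)) in e₂
  ...   | zero           = contradiction (trans (sym e₀) (swap e₂)) λ ()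
  ...   | suc zero       = contradiction (trans (sym (swap e₀)) (swap e₂)) λ ()
  ...   | suc (suc zero) = suc (suc zero) , e₂
  Fin3-involution-has-fixedPoint | suc (suc zero) with g (suc zero) in e₁
  ...   | zero           = contradiction (trans (sym e₀) (swap e₁)) λ ()
  ...   | suc zero       = suc zero , e₁
  ...   | suc (suc zero) = contradiction (trans (sym (swap e₀)) (swap e₁)) λ ()

partners-pigeonhole : ∀ {V : Set} {n r} (μ : V → V) (x : Fin n → V) (ρ : Fin r → V) → r < n →
                      Injective _≡_ _≡_ x → (∀ a → μ (μ (x a)) ≡ x a) →
                      ¬ (∀ a → ∃ λ i → μ (x a) ≡ ρ i)
partners-pigeonhole μ x ρ r<n x-injective μ-involutive partner∈ρ
  with a , b , a<b , same ← pigeonhole r<n (proj₁ ∘ partner∈ρ)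
  = <⇒≢ a<b (x-injective (begin
      x a                         ≡⟨ sym (μ-involutive a) ⟩
      μ (μ (x a))                 ≡⟨ cong μ (proj₂ (partner∈ρ a)) ⟩
      μ (ρ (proj₁ (partner∈ρ a))) ≡⟨ cong (μ ∘ ρ) same ⟩
      μ (ρ (proj₁ (partner∈ρ b))) ≡⟨ cong μ (sym (proj₂ (partner∈ρ b))) ⟩
      μ (μ (x b))                 ≡⟨ μ-involutive b ⟩
      x b                         ∎))
  where open ≡-Reasoning

module _ {a b} (G₁ : Graph a) (G₂ : Graph b) where

  ∪ᴳ-neighbourˡ : ∀ {x w} → (G₁ ∪ᴳ G₂) (x ↑ˡ b) w → ∃ λ y → w ≡ y ↑ˡ b × G₁ x y
  ∪ᴳ-neighbourˡ {x} {w} adj with splitView a w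
  ... | left y  rewrite splitAt-↑ˡ a x b | splitAt-↑ˡ a y b = y , refl , adj
  ... | right y rewrite splitAt-↑ˡ a x b | splitAt-↑ʳ a b y = ⊥-elim adj

  ∪ᴳ-neighbourʳ : ∀ {x w} → (G₁ ∪ᴳ G₂) (a ↑ʳ x) w → ∃ λ y → w ≡ a ↑ʳ y × G₂ x y
  ∪ᴳ-neighbourʳ {x} {w} adj with splitView a w
  ... | left y  rewrite splitAt-↑ʳ a b x | splitAt-↑ˡ a y b = ⊥-elim adj
  ... | right y rewrite splitAt-↑ʳ a b x | splitAt-↑ʳ a b y = y , refl , adj

  ∨ᴳ-neighbourʳ : ∀ {x w} → (G₁ ∨ᴳ G₂) (a ↑ʳ x) w →
                  (∃ λ y → w ≡ y ↑ˡ b) ⊎ (∃ λ y → w ≡ a ↑ʳ y × G₂ x y)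
  ∨ᴳ-neighbourʳ {x} {w} adj with splitView a w
  ... | left y  = inj₁ (y , refl)
  ... | right y rewrite splitAt-↑ʳ a b x | splitAt-↑ʳ a b y = inj₂ (y , refl , adj)

Edgeless : ∀ {n} → Graph n → Set
Edgeless G = ∀ {x y} → ¬ G x y

K1-edgeless : Edgeless (K 1)
K1-edgeless {zero} {zero} 0≢0 = 0≢0 refl

copies-edgeless : ∀ {m} {H : Graph m} → Edgeless H → ∀ a → Edgeless (copies a H)
copies-edgeless {m} {H} H-edgeless (suc a) {x} adj with splitView m x
... | left x′  = H-edgeless (proj₂ (proj₂ (∪ᴳ-neighbourˡ H (copies a H) adj)))
... | right x′ = copies-edgeless H-edgeless a (proj₂ (proj₂ (∪ᴳ-neighbourʳ H (copies a H) adj)))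

module _ (k r m : ℕ) where
  private
    B : ℕ
    B = m + (3 + r * 1)

    V : Set
    V = Fin (k + r + B)

    H : Graph (3 + r * 1)
    H = K 3 ∪ᴳ copies r (K 1)

    G : Graph (k + r + B)
    G = K (k + r) ∨ᴳ (K m ∪ᴳ H)

    S : Subset (k + r + B)
    S = (⊤ {k} ++ ∅ {r}) ++ ∅ {B}

    ∣S∣≡k : ∣ S ∣ ≡ k
    ∣S∣≡k = trans (∣p++∅∣≡∣p∣ (⊤ {k} ++ ∅ {r})) (trans (∣p++∅∣≡∣p∣ (⊤ {k})) (∣⊤∣≡n k))

    kept : Fin r → V
    kept i = (k ↑ʳ i) ↑ˡ B

    fromH : Fin (3 + r * 1) → V
    fromH z = (k + r) ↑ʳ (m ↑ʳ z)

    fromH-injective : Injective _≡_ _≡_ fromH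
    fromH-injective = ↑ʳ-injective m _ _ ∘ ↑ʳ-injective (k + r) _ _

    fromH∉S : ∀ z → fromH z ∉ S
    fromH∉S z = ∉∅ ∘ ∈-++⁻ʳ (⊤ {k} ++ ∅ {r}) {y = m ↑ʳ z}

    triangle : Fin 3 → V
    triangle t = fromH (t ↑ˡ r * 1)

    isolated : Fin (r * 1) → V
    isolated j = fromH (3 ↑ʳ j)

    fromH-neighbour : ∀ z w → w ∉ S → G (fromH z) w →
                      (∃ λ i → w ≡ kept i) ⊎ (∃ λ z′ → w ≡ fromH z′ × H z z′)
    fromH-neighbour z w w∉S adj with ∨ᴳ-neighbourʳ (K (k + r)) (K m ∪ᴳ H) adj
    ... | inj₂ (_ , refl , adj′) with ∪ᴳ-neighbourʳ (K m) H {z} adj′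
    ...   | z′ , refl , adj″ = inj₂ (z′ , refl , adj″)
    fromH-neighbour z w w∉S adj | inj₁ (y , refl) with splitView k y
    ...   | left i  = ⊥-elim (w∉S (∈-++⁺ˡ (∈-++⁺ˡ {q = ∅} ∈⊤)))
    ...   | right i = inj₁ (i , refl)

    isolated-edgeless : ∀ j {z} → ¬ H (3 ↑ʳ j) z
    isolated-edgeless j {z} adj =
      copies-edgeless K1-edgeless r (proj₂ (proj₂ (∪ᴳ-neighbourʳ (K 3) (copies r (K 1)) {j} {z} adj)))

    module _ (μ : V → V) (perfect : ∀ v → v ∉ S → (μ v ∉ S) × (μ v ≢ v) × G v (μ v) × (μ (μ v) ≡ v)) where

      KeptPartner : V → Set
      KeptPartner v = ∃ λ i → μ v ≡ kept i

      μ∘μ≡id-fromH : ∀ z → μ (μ (fromH z)) ≡ fromH z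
      μ∘μ≡id-fromH z = proj₂ (proj₂ (proj₂ (perfect (fromH z) (fromH∉S z))))

      fromH-partner : ∀ z → KeptPartner (fromH z) ⊎ (∃ λ z′ → μ (fromH z) ≡ fromH z′ × H z z′)
      fromH-partner z with perfect (fromH z) (fromH∉S z)
      ... | μz∉S , _ , adj , _ = fromH-neighbour z (μ (fromH z)) μz∉S adj

      isolated-keptPartner : ∀ j → KeptPartner (isolated j)
      isolated-keptPartner j with fromH-partner (3 ↑ʳ j)
      ... | inj₁ kept-partner   = kept-partner
      ... | inj₂ (z , _ , adj) = ⊥-elim (isolated-edgeless j {z} adj)

      triangle-partner : ∀ t → KeptPartner (triangle t) ⊎ (∃ λ t′ → μ (triangle t) ≡ triangle t′ × t ≢ t′)
      triangle-partner t with fromH-partner (t ↑ˡ r * 1)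
      ... | inj₁ kept-partner = inj₁ kept-partner
      ... | inj₂ (z , eq , adj) with ∪ᴳ-neighbourˡ (K 3) (copies r (K 1)) {t} {z} adj
      ...   | t′ , refl , t≢t′ = inj₂ (t′ , eq , t≢t′)

      triangle-partners-not-all-internal :
        ¬ (∀ t → ∃ λ t′ → μ (triangle t) ≡ triangle t′ × t ≢ t′)
      triangle-partners-not-all-internal internal =
        let t , gt≡t = Fin3-involution-has-fixedPoint g g∘g≡id
        in  proj₂ (proj₂ (internal t)) (sym gt≡t)
        where
        g : Fin 3 → Fin 3
        g t = proj₁ (internal t)

        g∘g≡id : ∀ t → g (g t) ≡ t
        g∘g≡id t = ↑ˡ-injective (r * 1) _ _ (fromH-injective (begin
          triangle (g (g t))   ≡⟨ sym (proj₁ (proj₂ (internal (g t)))) ⟩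
          μ (triangle (g t))   ≡⟨ cong μ (sym (proj₁ (proj₂ (internal t)))) ⟩
          μ (μ (triangle t))   ≡⟨ μ∘μ≡id-fromH (t ↑ˡ r * 1) ⟩
          triangle t           ∎))
          where open ≡-Reasoning

      some-triangle-keptPartner : ∃ λ t → KeptPartner (triangle t)
      some-triangle-keptPartner with ∃⊎∀ triangle-partner
      ... | inj₁ found    = found
      ... | inj₂ internal = ⊥-elim (triangle-partners-not-all-internal internal)

      no-perfect-matching : ⊥
      no-perfect-matching with t₀ , t₀-kept ← some-triangle-keptPartner =
        partners-pigeonhole μ (fromH ∘ σ) kept r<1+r*1
          (λ eq → σ-injective (fromH-injective eq)) (μ∘μ≡id-fromH ∘ σ) σ-kept
        where
        σ : Fin (suc (r * 1)) → Fin (3 + r * 1)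
        σ zero    = t₀ ↑ˡ r * 1
        σ (suc j) = 3 ↑ʳ j

        σ-injective : Injective _≡_ _≡_ σ
        σ-injective {zero}  {zero}  _  = refl
        σ-injective {zero}  {suc j} eq = ⊥-elim (↑ˡ≢↑ʳ t₀ j eq)
        σ-injective {suc i} {zero}  eq = ⊥-elim (↑ˡ≢↑ʳ t₀ i (sym eq))
        σ-injective {suc i} {suc j} eq = cong suc (↑ʳ-injective 3 i j eq)

        σ-kept : ∀ a → KeptPartner (fromH (σ a))
        σ-kept zero    = t₀-kept
        σ-kept (suc j) = isolated-keptPartner j

        r<1+r*1 : r < suc (r * 1)
        r<1+r*1 = ≤-reflexive (cong suc (sym (*-identityʳ r)))

  K[k+r]∨[Km∪K3∪rK1]-¬factorCritical : ¬ FactorCritical k (K (k + r) ∨ᴳ (K m ∪ᴳ (K 3 ∪ᴳ copies r (K 1))))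
  K[k+r]∨[Km∪K3∪rK1]-¬factorCritical factorCritical with μ , perfect ← factorCritical S ∣S∣≡k =
    no-perfect-matching μ perfect

lemma2p8 : (k δ n : ℕ) → 1 ≤ k → k + 1 ≤ δ →
           (∃ λ t → n ≡ k + 2 * suc t) →
           1 + (2 * δ + 3) ≤ n + k →
           ¬ FactorCritical k
               (K δ ∨ᴳ (K (n + k ∸ (2 * δ + 3)) ∪ᴳ (K 3 ∪ᴳ copies (δ ∸ k) (K 1))))
lemma2p8 k δ n _ k+1≤δ _ _ =
  subst (λ d → ¬ FactorCritical k (K d ∨ᴳ (K m ∪ᴳ (K 3 ∪ᴳ copies (δ ∸ k) (K 1)))))
        (m+[n∸m]≡n (≤-trans (m≤m+n k 1) k+1≤δ))
        (K[k+r]∨[Km∪K3∪rK1]-¬factorCritical k (δ ∸ k) m)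
  where
  m : ℕ
  m = n + k ∸ (2 * δ + 3)
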